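{- Let $m,n$ be positive integers with $n\equiv 0\pmod 2$. If either $m\equiv 0\pmod 3$ and $mn\equiv 6,12\pmod{24}$, or $mn\equiv 14,20\pmod{24}$, then $\Phi(m\times n,3,1)\le J(m\times n,3,1)-1$.
   Context: Let $I_m=\{0,1,\dots,m-1\}$ and $\mathbb{Z}_n$ the integers modulo $n$. A $2$-D $(m\times n,k,1)$-OOC is a set $\mathcal{C}$ of $k$-subsets of $I_m\times\mathbb{Z}_n$ such that $|A\cap(A+\tau)|\le 1$ for every $A\in\mathcal{C}$ and every integer $\tau\not\equiv 0\pmod n$, and $|A\cap(B+\tau)|\le 1$ for all distinct $A,B\in\mathcal{C}$ and every integer $\tau$, where $B+\tau=\{(i,x+\tau \bmod n):(i,x)\in B\}$. $\Phi(m\times n,k,1)$ denotes the largest possible number of codewords of such a code. $J(m\times n,3,1)=\left\lfloor \frac{m}{3}\left\lfloor\frac{mn-1}{2}\right\rfloor\right\rfloor$. -}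

module Defs where

open import Data.Nat using (ℕ; zero; suc; _+_; _*_; _/_; _≤_; _<_)
open import Data.Nat.DivMod using (_mod_)
open import Data.Nat.Divisibility using (_∣_)
open import Data.Fin using (Fin; toℕ)
import Data.Fin.Properties as FinP
open import Data.Product using (_×_; _,_)
open import Data.Product.Properties using (≡-dec)
open import Data.List using (List; length; filter; map; lookup)
open import Data.List.Relation.Unary.Unique.Propositional using (Unique)
open import Relation.Binary.PropositionalEquality using (_≡_)
open import Relation.Binary.Definitions using (DecidableEquality)
open import Relation.Nullary using (¬_)
import Data.List.Membership.DecPropositional as DecMem

-- Points of I_m × Z_n : (row i, column x), x read as a residue mod n.
Point : ℕ → ℕ → Set
Point m n = Fin m × Fin n

_≟P_ : ∀ {m n} → DecidableEquality (Point m n)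
_≟P_ = ≡-dec FinP._≟_ FinP._≟_

shiftPt : ∀ {m n} → ℕ → Point m n → Point m n
shiftPt {n = suc k} τ (i , x) = i , ((toℕ x + τ) mod suc k)

shift : ∀ {m n} → ℕ → List (Point m n) → List (Point m n)
shift τ B = map (shiftPt τ) B

-- |A ∩ B| for A a duplicate-free list
interCard : ∀ {m n} → List (Point m n) → List (Point m n) → ℕ
interCard {m} {n} A B = length (filter (λ p → p ∈? B) A)
  where open DecMem (_≟P_ {m} {n})

record KSubset (m n k : ℕ) : Set where
  constructor ksub
  field
    elems  : List (Point m n)
    unique : Unique elems
    size   : length elems ≡ k
open KSubset public

-- A 2-D (m × n, k, 1)-OOC, listed without repetition: codewords at
-- distinct positions are distinct codewords (enforced by the cross condition).
record IsOOC (m n k : ℕ) (C : List (KSubset m n k)) : Set where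
  field
    auto  : ∀ (a : Fin (length C)) (τ : ℕ) → ¬ (n ∣ τ) →
              interCard (elems (lookup C a)) (shift τ (elems (lookup C a))) ≤ 1
    cross : ∀ (a b : Fin (length C)) → ¬ (a ≡ b) → (τ : ℕ) →
              interCard (elems (lookup C a)) (shift τ (elems (lookup C b))) ≤ 1

-- J(m × n, 3, 1) = ⌊ (m/3) ⌊ (mn-1)/2 ⌋ ⌋ = ⌊ m ⌊(mn-1)/2⌋ / 3 ⌋  (for m n ≥ 1)
J3 : ℕ → ℕ → ℕ
J3 m n = (m * ((m * n Data.Nat.∸ 1) / 2)) / 3

-- Write n = 2b and M = m·m·b.  The difference of an ordered pair of points (i , x), (j , y)
-- is (i , j , y − x mod n); of the m·m·n = 2M differences, M have y − x odd.  The OOC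
-- conditions make the differences of pairs of distinct points of the codewords pairwise
-- distinct and keep them off the diagonal differences (i , i , 0) and (i , i , b): a
-- codeword with two points of one row at distance b meets its translate by b twice.  A
-- codeword has 0 or 2 pairs of columns of unequal parity, so it yields a multiple of 4 odd
-- differences.  The conditions on mn give 6J + 2m = 2M, so if |C| ≥ J the used and the
-- diagonal differences exhaust both parity classes, whence M ≡ m·(b mod 2) (mod 4).  But
-- the conditions also give mb ≡ 2 or 3 (mod 4), and then this congruence fails.
module Submission where

open import Defs
open import Data.Nat using (ℕ; _*_; _%_; _<_; _≥_)
open import Data.Nat.Divisibility using (_∣_)
open import Data.List using (List; length)
open import Data.Product using (_×_)
open import Data.Sum using (_⊎_)
open import Relation.Binary.PropositionalEquality using (_≡_)

open import Level using (Level)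
open import Function using (_∘_)
open import Data.Nat
open import Data.Nat.Properties
open import Data.Nat.DivMod
  using (_mod_; m%n<n; %-distribˡ-+; %-distribˡ-*; m%n%n≡m%n; [m+n]%n≡m%n; [m+kn]%n≡m%n;
         %-remove-+ʳ; m<n⇒m%n≡m; m≡m%n+[m/n]*n; m%n*o≡m*o%[n*o]; m∣n⇒o%n%m≡o%m;
         +-distrib-/-∣ʳ; m*n/n≡m; m/n*n≡m)
open import Data.Nat.Divisibility
  using (divides; _∣?_; _∣0; ∣-refl; >⇒∤; ∣m⇒∣m*n; ∣n⇒∣m*n; ∣m∣n⇒∣m+n)
open import Data.Nat.Tactic.RingSolver using (solve-∀)
open import Data.Fin as Fin using (Fin; toℕ; fromℕ<; combine)
open import Data.Fin.Properties
  using (toℕ-fromℕ<; toℕ-injective; toℕ<n; toℕ≤n; toℕ-combine; combine-injective; all?)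
open import Data.Parity.Base as ℙ using (Parity; 0ℙ; 1ℙ)
import Data.Parity.Properties as ℙ
open import Data.List using ([]; _∷_; map; filter; _++_; concat; tabulate; lookup)
open import Data.List.Properties
  using (length-map; length-++; length-tabulate; filter-all; filter-accept; filter-reject;
         filter-++; map-∘; map-cong)
open import Data.List.Membership.Propositional using (_∈_; _∉_)
open import Data.List.Membership.Propositional.Properties
  using (∈-length; ∈-map⁺; ∈-map⁻; ∈-++⁻; ∈-filter⁺; ∈-filter⁻; ∈-concat⁻′; ∈-tabulate⁻)
import Data.List.Membership.DecPropositional as DecMembership
open import Data.List.Relation.Unary.Any using (here; there)
open import Data.List.Relation.Unary.All as All using (All; []; _∷_)
import Data.List.Relation.Unary.All.Properties as All
import Data.List.Relation.Unary.AllPairs.Properties as AllPairs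
open import Data.List.Relation.Unary.Unique.Propositional using (Unique; []; _∷_)
import Data.List.Relation.Unary.Unique.Propositional.Properties as Unique
open import Data.List.Relation.Binary.Disjoint.Propositional using (Disjoint)
open import Data.Product using (_,_; proj₁; proj₂; uncurry; map₁; ∃-syntax)
open import Data.Sum as Sum using (inj₁; inj₂)
open import Relation.Nullary using (¬_; yes; no; contradiction)
open import Relation.Nullary.Decidable using (¬?; toWitness; _⊎-dec_; _→-dec_)
open import Relation.Binary.PropositionalEquality
  using (_≢_; refl; sym; trans; cong; cong₂; subst; module ≡-Reasoning)

private
  variable
    a : Level
    A B : Set a

2≤length : ∀ {xs : List A} {x y} → x ∈ xs → y ∈ xs → x ≢ y → 2 ≤ length xs
2≤length (here refl) (here refl) x≢y = contradiction refl x≢y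
2≤length (here _)    (there y∈)  _   = s≤s (∈-length y∈)
2≤length (there x∈)  (here _)    _   = s≤s (∈-length x∈)
2≤length (there x∈)  (there y∈)  x≢y = m≤n⇒m≤1+n (2≤length x∈ y∈ x≢y)

unique-map⁺ : ∀ {f : A → B} {xs} → (∀ {x y} → x ∈ xs → y ∈ xs → f x ≡ f y → x ≡ y) →
              Unique xs → Unique (map f xs)
unique-map⁺ {xs = []}     _   []         = []
unique-map⁺ {xs = x ∷ xs} inj (x∉ ∷ xs!) =
  All.map⁺ (All.tabulate λ y∈ fx≡fy → All.lookup x∉ y∈ (inj (here refl) (there y∈) fx≡fy))
  ∷ unique-map⁺ (λ x∈ y∈ → inj (there x∈) (there y∈)) xs!

length≤1+length-filter-≢ : ∀ v {xs : List ℕ} → Unique xs →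
                           length xs ≤ suc (length (filter (λ y → ¬? (y ≟ v)) xs))
length≤1+length-filter-≢ v {[]}     []         = z≤n
length≤1+length-filter-≢ v {x ∷ xs} (x∉ ∷ xs!) with x ≟ v
... | yes refl = s≤s (≤-reflexive (cong length (sym (begin
  filter ≢x? (x ∷ xs)  ≡⟨ filter-reject ≢x? (λ x≢x → x≢x refl) ⟩
  filter ≢x? xs        ≡⟨ filter-all ≢x? (All.map (λ x≢y y≡x → x≢y (sym y≡x)) x∉) ⟩
  xs                   ∎))))
  where
    open ≡-Reasoning
    ≢x? = λ y → ¬? (y ≟ x)
... | no x≢v   = ≤-trans (s≤s (length≤1+length-filter-≢ v xs!))
                   (≤-reflexive (cong (suc ∘ length) (sym (filter-accept (λ y → ¬? (y ≟ v)) x≢v))))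

unique-bounded⇒length≤ : ∀ B {xs} → Unique xs → All (_< B) xs → length xs ≤ B
unique-bounded⇒length≤ zero    {[]}    _   _          = z≤n
unique-bounded⇒length≤ zero    {_ ∷ _} _   (() ∷ _)
unique-bounded⇒length≤ (suc B) {xs}    xs! xs<1+B = begin
  length xs                      ≤⟨ length≤1+length-filter-≢ B xs! ⟩
  suc (length (filter ≢B? xs))   ≤⟨ s≤s (unique-bounded⇒length≤ B (Unique.filter⁺ ≢B? xs!) ys<B) ⟩
  suc B                          ∎
  where
    open ≤-Reasoning
    ≢B? = λ y → ¬? (y ≟ B)
    ys<B : All (_< B) (filter ≢B? xs)
    ys<B = All.tabulate λ y∈ → let y∈xs , y≢B = ∈-filter⁻ ≢B? y∈ in
      ≤∧≢⇒< (s≤s⁻¹ (All.lookup xs<1+B y∈xs)) y≢B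

length-concat-uniform : ∀ {c} (xss : List (List A)) → All (λ xs → length xs ≡ c) xss →
                        length (concat xss) ≡ length xss * c
length-concat-uniform []         []             = refl
length-concat-uniform (xs ∷ xss) (|xs| ∷ |xss|) =
  trans (length-++ xs) (cong₂ _+_ |xs| (length-concat-uniform xss |xss|))

orderedPairs : List A → List (A × A)
orderedPairs []       = []
orderedPairs (x ∷ xs) = map (x ,_) xs ++ map (_, x) xs ++ orderedPairs xs

∈-orderedPairs⁻ : ∀ {xs : List A} {pq} → Unique xs → pq ∈ orderedPairs xs →
                  proj₁ pq ∈ xs × proj₂ pq ∈ xs × proj₁ pq ≢ proj₂ pq
∈-orderedPairs⁻ {xs = x ∷ xs} (x∉ ∷ xs!) pq∈ with ∈-++⁻ (map (x ,_) xs) pq∈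
... | inj₁ pq∈₁ with y , y∈ , refl ← ∈-map⁻ (x ,_) pq∈₁ = here refl , there y∈ , All.lookup x∉ y∈
... | inj₂ pq∈₂ with ∈-++⁻ (map (_, x) xs) pq∈₂
...   | inj₁ pq∈₁ with y , y∈ , refl ← ∈-map⁻ (_, x) pq∈₁ =
  there y∈ , here refl , λ y≡x → All.lookup x∉ y∈ (sym y≡x)
...   | inj₂ pq∈₃ with p∈ , q∈ , p≢q ← ∈-orderedPairs⁻ xs! pq∈₃ = there p∈ , there q∈ , p≢q

orderedPairs⁺ : ∀ {xs : List A} → Unique xs → Unique (orderedPairs xs)
orderedPairs⁺ {xs = []}     []         = []
orderedPairs⁺ {xs = x ∷ xs} (x∉ ∷ xs!) =
  Unique.++⁺ (Unique.map⁺ (λ { refl → refl }) xs!)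
             (Unique.++⁺ (Unique.map⁺ (λ { refl → refl }) xs!) (orderedPairs⁺ xs!) disjoint₂)
             disjoint₁
  where
    x∉xs : x ∉ xs
    x∉xs x∈ = All.lookup x∉ x∈ refl
    disjoint₂ : Disjoint (map (_, x) xs) (orderedPairs xs)
    disjoint₂ (pq∈₁ , pq∈₂) with _ , _ , refl ← ∈-map⁻ (_, x) pq∈₁ =
      x∉xs (proj₁ (proj₂ (∈-orderedPairs⁻ xs! pq∈₂)))
    disjoint₁ : Disjoint (map (x ,_) xs) (map (_, x) xs ++ orderedPairs xs)
    disjoint₁ (pq∈₁ , pq∈₂) with _ , _ , refl ← ∈-map⁻ (x ,_) pq∈₁ with ∈-++⁻ (map (_, x) xs) pq∈₂
    ... | inj₁ pq∈ with _ , y∈ , refl ← ∈-map⁻ (_, x) pq∈ = x∉xs y∈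
    ... | inj₂ pq∈ = x∉xs (proj₁ (∈-orderedPairs⁻ xs! pq∈))

-- Parity

ofParity : Parity → List ℕ → List ℕ
ofParity p = filter (λ y → parity y ℙ.≟ p)

length-ofParity : ∀ xs → length (ofParity 0ℙ xs) + length (ofParity 1ℙ xs) ≡ length xs
length-ofParity []       = refl
length-ofParity (x ∷ xs) with parity x
... | 0ℙ = cong suc (length-ofParity xs)
... | 1ℙ = trans (+-suc _ _) (cong suc (length-ofParity xs))

length-ofParity-map : ∀ p xs → length (ofParity p xs) ≡ length (filter (ℙ._≟ p) (map parity xs))
length-ofParity-map p []       = refl
length-ofParity-map p (x ∷ xs) with parity x ℙ.≟ p
... | yes _ = cong suc (length-ofParity-map p xs)
... | no  _ = length-ofParity-map p xs

∣-length-ofParity-concat : ∀ {d p} (xss : List (List ℕ)) →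
                           All (λ xs → d ∣ length (ofParity p xs)) xss →
                           d ∣ length (ofParity p (concat xss))
∣-length-ofParity-concat         []         []             = _ ∣0
∣-length-ofParity-concat {p = p} (xs ∷ xss) (d∣xs ∷ d∣xss) =
  subst (_ ∣_) (sym (trans (cong length (filter-++ _ xs (concat xss))) (length-++ (ofParity p xs))))
        (∣m∣n⇒∣m+n d∣xs (∣-length-ofParity-concat xss d∣xss))

bit : Parity → ℕ
bit 0ℙ = 0
bit 1ℙ = 1

length-ofParity-constant : ∀ p {xs} → All (λ y → parity y ≡ p) xs →
                           length (ofParity 1ℙ xs) ≡ length xs * bit p
length-ofParity-constant p  {[]}     []         = refl
length-ofParity-constant 0ℙ {x ∷ xs} (px ∷ pxs) rewrite px = length-ofParity-constant 0ℙ pxs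
length-ofParity-constant 1ℙ {x ∷ xs} (px ∷ pxs) rewrite px = cong suc (length-ofParity-constant 1ℙ pxs)

parity-⌊/2⌋-injective : ∀ {x y} → parity x ≡ parity y → ⌊ x /2⌋ ≡ ⌊ y /2⌋ → x ≡ y
parity-⌊/2⌋-injective {0}           {0}           _ _ = refl
parity-⌊/2⌋-injective {1}           {1}           _ _ = refl
parity-⌊/2⌋-injective {suc (suc x)} {suc (suc y)} px≡py ⌊x⌋≡⌊y⌋ =
  cong (suc ∘ suc) (parity-⌊/2⌋-injective px≡py (suc-injective ⌊x⌋≡⌊y⌋))
parity-⌊/2⌋-injective {0}           {1}           () _
parity-⌊/2⌋-injective {1}           {0}           () _
parity-⌊/2⌋-injective {0}           {suc (suc _)} _ ()
parity-⌊/2⌋-injective {1}           {suc (suc _)} _ ()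
parity-⌊/2⌋-injective {suc (suc _)} {0}           _ ()
parity-⌊/2⌋-injective {suc (suc _)} {1}           _ ()

⌊/2⌋-< : ∀ {x B} → x < B + B → ⌊ x /2⌋ < B
⌊/2⌋-< {x} {B} x<B+B = ≰⇒> λ B≤⌊x⌋ → <⇒≱ x<B+B (begin
  B + B                  ≤⟨ +-mono-≤ B≤⌊x⌋ B≤⌊x⌋ ⟩
  ⌊ x /2⌋ + ⌊ x /2⌋      ≤⟨ +-monoʳ-≤ ⌊ x /2⌋ (⌊n/2⌋≤⌈n/2⌉ x) ⟩
  ⌊ x /2⌋ + ⌈ x /2⌉      ≡⟨ ⌊n/2⌋+⌈n/2⌉≡n x ⟩
  x                      ∎)
  where open ≤-Reasoning

length-ofParity≤ : ∀ B p {xs} → Unique xs → All (_< B + B) xs → length (ofParity p xs) ≤ B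
length-ofParity≤ B p {xs} xs! xs<B+B = begin
  length ys               ≡⟨ length-map ⌊_/2⌋ ys ⟨
  length (map ⌊_/2⌋ ys)   ≤⟨ unique-bounded⇒length≤ B
                               (unique-map⁺ halving-injective (Unique.filter⁺ _ xs!))
                               (All.map⁺ (All.map ⌊/2⌋-< (All.filter⁺ _ xs<B+B))) ⟩
  B                       ∎
  where
    open ≤-Reasoning
    ys = ofParity p xs
    halving-injective : ∀ {x y} → x ∈ ys → y ∈ ys → ⌊ x /2⌋ ≡ ⌊ y /2⌋ → x ≡ y
    halving-injective x∈ y∈ = parity-⌊/2⌋-injective
      (trans (All.lookup (All.all-filter _ xs) x∈) (sym (All.lookup (All.all-filter _ xs) y∈)))

parity-even+ : ∀ e d → parity e ≡ 0ℙ → parity (e + d) ≡ parity d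
parity-even+ e d e-even = trans (ℙ.+-homo-+ e d) (cong (ℙ._+ parity d) e-even)

parity-*even : ∀ q n → parity n ≡ 0ℙ → parity (q * n) ≡ 0ℙ
parity-*even q n n-even = trans (ℙ.*-homo-* q n) (trans (cong (parity q ℙ.*_) n-even) (ℙ.*-zeroʳ _))

parity-% : ∀ a n .{{_ : NonZero n}} → parity n ≡ 0ℙ → parity (a % n) ≡ parity a
parity-% a n n-even = begin
  parity (a % n)               ≡⟨ parity-even+ (a / n * n) (a % n) (parity-*even (a / n) n n-even) ⟨
  parity (a / n * n + a % n)   ≡⟨ cong parity (+-comm (a / n * n) (a % n)) ⟩
  parity (a % n + a / n * n)   ≡⟨ cong parity (m≡m%n+[m/n]*n a n) ⟨
  parity a                     ∎
  where open ≡-Reasoning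

parity-∸ : ∀ {x n} → parity n ≡ 0ℙ → x ≤ n → parity (n ∸ x) ≡ parity x
parity-∸ {x} {n} n-even x≤n = ℙ.+-cancelʳ-≡ (parity x) _ _ (begin
  parity (n ∸ x) ℙ.+ parity x   ≡⟨ ℙ.+-homo-+ (n ∸ x) x ⟨
  parity (n ∸ x + x)            ≡⟨ cong parity (m∸n+n≡m x≤n) ⟩
  parity n                      ≡⟨ n-even ⟩
  0ℙ                            ≡⟨ ℙ.p+p≡0ℙ (parity x) ⟨
  parity x ℙ.+ parity x         ∎)
  where open ≡-Reasoning

4∣odd-pairSums₃ : ∀ P₁ P₂ P₃ →
  4 ∣ length (filter (ℙ._≟ 1ℙ) (map (uncurry ℙ._+_) (orderedPairs (P₁ ∷ P₂ ∷ P₃ ∷ []))))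
4∣odd-pairSums₃ 0ℙ 0ℙ 0ℙ = divides 0 refl
4∣odd-pairSums₃ 0ℙ 0ℙ 1ℙ = divides 1 refl
4∣odd-pairSums₃ 0ℙ 1ℙ 0ℙ = divides 1 refl
4∣odd-pairSums₃ 0ℙ 1ℙ 1ℙ = divides 1 refl
4∣odd-pairSums₃ 1ℙ 0ℙ 0ℙ = divides 1 refl
4∣odd-pairSums₃ 1ℙ 0ℙ 1ℙ = divides 1 refl
4∣odd-pairSums₃ 1ℙ 1ℙ 0ℙ = divides 1 refl
4∣odd-pairSums₃ 1ℙ 1ℙ 1ℙ = divides 0 refl

toℕ-mod : ∀ a n .{{_ : NonZero n}} → toℕ (a mod n) ≡ a % n
toℕ-mod a n = toℕ-fromℕ< (m%n<n a n)

[m+n%d]%d≡[m+n]%d : ∀ a b d .{{_ : NonZero d}} → (a + b % d) % d ≡ (a + b) % d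
[m+n%d]%d≡[m+n]%d a b d = begin
  (a + b % d) % d           ≡⟨ %-distribˡ-+ a (b % d) d ⟩
  (a % d + b % d % d) % d   ≡⟨ cong (λ c → (a % d + c) % d) (m%n%n≡m%n b d) ⟩
  (a % d + b % d) % d       ≡⟨ %-distribˡ-+ a b d ⟨
  (a + b) % d               ∎
  where open ≡-Reasoning

%-*-cong : ∀ d .{{_ : NonZero d}} a a′ c c′ → a % d ≡ a′ % d → c % d ≡ c′ % d →
           a * c % d ≡ a′ * c′ % d
%-*-cong d a a′ c c′ a≡a′ c≡c′ = begin
  a * c % d                 ≡⟨ %-distribˡ-* a c d ⟩
  (a % d) * (c % d) % d     ≡⟨ cong₂ (λ x y → x * y % d) a≡a′ c≡c′ ⟩
  (a′ % d) * (c′ % d) % d   ≡⟨ %-distribˡ-* a′ c′ d ⟨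
  a′ * c′ % d               ∎
  where open ≡-Reasoning

sum-squeeze : ∀ {x y M} → x ≤ M → y ≤ M → M + M ≤ x + y → y ≡ M
sum-squeeze x≤M y≤M M+M≤x+y = ≤-antisym y≤M (≮⇒≥ λ y<M → <⇒≱ (+-mono-≤-< x≤M y<M) M+M≤x+y)

-- Columns in ℤ/n and differences of points

module _ {k : ℕ} where
  private
    n : ℕ
    n = suc k

  shiftCol : ℕ → Fin n → Fin n
  shiftCol τ x = (toℕ x + τ) mod n

  colDiff : Fin n → Fin n → Fin n
  colDiff x y = (n ∸ toℕ x + toℕ y) mod n

  shiftCol-+ : ∀ σ τ x → shiftCol τ (shiftCol σ x) ≡ shiftCol (σ + τ) x
  shiftCol-+ σ τ x = toℕ-injective (begin
    toℕ (shiftCol τ (shiftCol σ x))  ≡⟨ toℕ-mod (toℕ (shiftCol σ x) + τ) n ⟩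
    (toℕ (shiftCol σ x) + τ) % n     ≡⟨ cong (λ c → (c + τ) % n) (toℕ-mod (toℕ x + σ) n) ⟩
    ((toℕ x + σ) % n + τ) % n        ≡⟨ cong (_% n) (+-comm _ τ) ⟩
    (τ + (toℕ x + σ) % n) % n        ≡⟨ [m+n%d]%d≡[m+n]%d τ (toℕ x + σ) n ⟩
    (τ + (toℕ x + σ)) % n            ≡⟨ cong (_% n) (trans (+-comm τ _) (+-assoc (toℕ x) σ τ)) ⟩
    (toℕ x + (σ + τ)) % n            ≡⟨ toℕ-mod (toℕ x + (σ + τ)) n ⟨
    toℕ (shiftCol (σ + τ) x)         ∎)
    where open ≡-Reasoning

  shiftCol-∣ : ∀ {τ} → n ∣ τ → ∀ x → shiftCol τ x ≡ x
  shiftCol-∣ {τ} n∣τ x = toℕ-injective (begin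
    toℕ (shiftCol τ x)   ≡⟨ toℕ-mod (toℕ x + τ) n ⟩
    (toℕ x + τ) % n      ≡⟨ %-remove-+ʳ (toℕ x) n∣τ ⟩
    toℕ x % n            ≡⟨ m<n⇒m%n≡m (toℕ<n x) ⟩
    toℕ x                ∎)
    where open ≡-Reasoning

  shiftCol-colDiff : ∀ x y → shiftCol (toℕ (colDiff x y)) x ≡ y
  shiftCol-colDiff x y = toℕ-injective (begin
    toℕ (shiftCol (toℕ (colDiff x y)) x)     ≡⟨ toℕ-mod (toℕ x + toℕ (colDiff x y)) n ⟩
    (toℕ x + toℕ (colDiff x y)) % n
      ≡⟨ cong (λ c → (toℕ x + c) % n) (toℕ-mod (n ∸ toℕ x + toℕ y) n) ⟩
    (toℕ x + (n ∸ toℕ x + toℕ y) % n) % n    ≡⟨ [m+n%d]%d≡[m+n]%d (toℕ x) (n ∸ toℕ x + toℕ y) n ⟩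
    (toℕ x + (n ∸ toℕ x + toℕ y)) % n        ≡⟨ cong (_% n) (+-assoc (toℕ x) _ _) ⟨
    (toℕ x + (n ∸ toℕ x) + toℕ y) % n        ≡⟨ cong (λ c → (c + toℕ y) % n) (m+[n∸m]≡n (toℕ≤n x)) ⟩
    (n + toℕ y) % n                          ≡⟨ cong (_% n) (+-comm n (toℕ y)) ⟩
    (toℕ y + n) % n                          ≡⟨ [m+n]%n≡m%n (toℕ y) n ⟩
    toℕ y % n                                ≡⟨ m<n⇒m%n≡m (toℕ<n y) ⟩
    toℕ y                                    ∎)
    where open ≡-Reasoning

  colDiff-translate : ∀ {x y x′ y′} → colDiff x y ≡ colDiff x′ y′ →
                      shiftCol (toℕ (colDiff x′ x)) y′ ≡ y
  colDiff-translate {x} {y} {x′} {y′} eq = begin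
    shiftCol τ y′                   ≡⟨ cong (shiftCol τ) (shiftCol-colDiff x′ y′) ⟨
    shiftCol τ (shiftCol δ x′)      ≡⟨ shiftCol-+ δ τ x′ ⟩
    shiftCol (δ + τ) x′             ≡⟨ cong (λ c → shiftCol c x′) (+-comm δ τ) ⟩
    shiftCol (τ + δ) x′             ≡⟨ shiftCol-+ τ δ x′ ⟨
    shiftCol δ (shiftCol τ x′)      ≡⟨ cong (shiftCol δ) (shiftCol-colDiff x′ x) ⟩
    shiftCol δ x                    ≡⟨ cong (λ d → shiftCol (toℕ d) x) eq ⟨
    shiftCol (toℕ (colDiff x y)) x  ≡⟨ shiftCol-colDiff x y ⟩
    y                               ∎
    where
      open ≡-Reasoning
      τ = toℕ (colDiff x′ x)
      δ = toℕ (colDiff x′ y′)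

  parity-colDiff : parity n ≡ 0ℙ → ∀ x y →
                   parity (toℕ (colDiff x y)) ≡ parity (toℕ x) ℙ.+ parity (toℕ y)
  parity-colDiff n-even x y = begin
    parity (toℕ (colDiff x y))              ≡⟨ cong parity (toℕ-mod (n ∸ toℕ x + toℕ y) n) ⟩
    parity ((n ∸ toℕ x + toℕ y) % n)        ≡⟨ parity-% (n ∸ toℕ x + toℕ y) n n-even ⟩
    parity (n ∸ toℕ x + toℕ y)              ≡⟨ ℙ.+-homo-+ (n ∸ toℕ x) (toℕ y) ⟩
    parity (n ∸ toℕ x) ℙ.+ parity (toℕ y)   ≡⟨ cong (ℙ._+ parity (toℕ y)) (parity-∸ n-even (toℕ≤n x)) ⟩
    parity (toℕ x) ℙ.+ parity (toℕ y)       ∎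
    where open ≡-Reasoning

module _ {m k : ℕ} where
  private
    n : ℕ
    n = suc k

  shiftPt-+ : ∀ σ τ (p : Point m n) → shiftPt τ (shiftPt σ p) ≡ shiftPt (σ + τ) p
  shiftPt-+ σ τ (i , x) = cong (i ,_) (shiftCol-+ σ τ x)

  shiftPt-∣ : ∀ {τ} → n ∣ τ → (p : Point m n) → shiftPt τ p ≡ p
  shiftPt-∣ n∣τ (i , x) = cong (i ,_) (shiftCol-∣ n∣τ x)

  -- The difference of (i , x) and (j , y) is the triple (i , j , y − x mod n), coded
  -- injectively by a number below m·m·n.  Both definitions are opaque so that an equation
  -- between two codes determines their arguments during unification.
  opaque
    diffCode : Fin m → Fin m → Fin n → ℕ
    diffCode i j d = toℕ (combine (combine i j) d)

    diffCode-injective : ∀ {i j d i′ j′ d′} → diffCode i j d ≡ diffCode i′ j′ d′ →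
                         i ≡ i′ × j ≡ j′ × d ≡ d′
    diffCode-injective eq
      with ij≡ , d≡ ← combine-injective _ _ _ _ (toℕ-injective eq)
      with i≡ , j≡ ← combine-injective _ _ _ _ ij≡
      = i≡ , j≡ , d≡

    diffCode< : ∀ i j d → diffCode i j d < m * m * n
    diffCode< i j d = toℕ<n (combine (combine i j) d)

    parity-diffCode : parity n ≡ 0ℙ → ∀ i j d → parity (diffCode i j d) ≡ parity (toℕ d)
    parity-diffCode n-even i j d = begin
      parity (diffCode i j d)   ≡⟨ cong parity (toℕ-combine (combine i j) d) ⟩
      parity (n * c + toℕ d)    ≡⟨ parity-even+ (n * c) (toℕ d) nc-even ⟩
      parity (toℕ d)            ∎
      where
        open ≡-Reasoning
        c : ℕ
        c = toℕ (combine i j)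
        nc-even : parity (n * c) ≡ 0ℙ
        nc-even = trans (ℙ.*-homo-* n c) (cong (ℙ._* parity c) n-even)

  opaque
    difference : Point m n → Point m n → ℕ
    difference (i , x) (j , y) = diffCode i j (colDiff x y)

    difference< : ∀ (p q : Point m n) → difference p q < m * m * n
    difference< (i , x) (j , y) = diffCode< i j (colDiff x y)

    difference-translate : ∀ {p q p′ q′ : Point m n} → difference p q ≡ difference p′ q′ →
                           let τ = toℕ (colDiff (proj₂ p′) (proj₂ p)) in
                           shiftPt τ p′ ≡ p × shiftPt τ q′ ≡ q
    difference-translate {i , x} {j , y} {_ , x′} {_ , y′} eq
      with refl , refl , d≡ ← diffCode-injective eq
      = cong (i ,_) (shiftCol-colDiff x′ x) , cong (j ,_) (colDiff-translate {x = x} {y} {x′} {y′} d≡)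

    difference-diagonal : ∀ {p q : Point m n} {i d} → difference p q ≡ diffCode i i d →
                          shiftPt (toℕ d) p ≡ q
    difference-diagonal {_ , x} {_ , y} eq
      with refl , refl , refl ← diffCode-injective eq
      = cong (_ ,_) (shiftCol-colDiff x y)

    parity-difference : parity n ≡ 0ℙ → ∀ (p q : Point m n) →
                        parity (difference p q) ≡ parity (toℕ (proj₂ p)) ℙ.+ parity (toℕ (proj₂ q))
    parity-difference n-even (i , x) (j , y) =
      trans (parity-diffCode n-even i j (colDiff x y)) (parity-colDiff n-even x y)

  difference≢diagonal-zero : ∀ {p q : Point m n} {i} → p ≢ q → difference p q ≢ diffCode i i Fin.zero
  difference≢diagonal-zero {p} p≢q eq = p≢q (trans (sym (shiftPt-∣ (n ∣0) p)) (difference-diagonal eq))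

  interCard≥2 : ∀ {A B : List (Point m n)} {p q} → p ≢ q → p ∈ A → q ∈ A → p ∈ B → q ∈ B →
                2 ≤ interCard A B
  interCard≥2 {B = B} p≢q p∈A q∈A p∈B q∈B =
    2≤length (∈-filter⁺ (_∈? B) p∈A p∈B) (∈-filter⁺ (_∈? B) q∈A q∈B) p≢q
    where open DecMembership (_≟P_ {m} {n}) using (_∈?_)

  differences : List (Point m n) → List ℕ
  differences xs = map (uncurry difference) (orderedPairs xs)

  ∈-differences⁻ : ∀ {xs d} → Unique xs → d ∈ differences xs →
                   ∃[ p ] ∃[ q ] p ∈ xs × q ∈ xs × p ≢ q × d ≡ difference p q
  ∈-differences⁻ xs! d∈
    with (p , q) , pq∈ , refl ← ∈-map⁻ (uncurry difference) d∈
    with p∈ , q∈ , p≢q ← ∈-orderedPairs⁻ xs! pq∈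
    = p , q , p∈ , q∈ , p≢q , refl

  length-differences₃ : ∀ (xs : List (Point m n)) → length xs ≡ 3 → length (differences xs) ≡ 6
  length-differences₃ (_ ∷ _ ∷ _ ∷ []) refl = refl

  4∣odd-differences₃ : parity n ≡ 0ℙ → ∀ (xs : List (Point m n)) → length xs ≡ 3 →
                       4 ∣ length (ofParity 1ℙ (differences xs))
  4∣odd-differences₃ n-even xs@(p₁ ∷ p₂ ∷ p₃ ∷ []) refl =
    subst (4 ∣_) (sym odd≡) (4∣odd-pairSums₃ (colParity p₁) (colParity p₂) (colParity p₃))
    where
      open ≡-Reasoning
      colParity : Point m n → Parity
      colParity p = parity (toℕ (proj₂ p))
      ps = orderedPairs xs
      odd≡ : length (ofParity 1ℙ (differences xs)) ≡
             length (filter (ℙ._≟ 1ℙ) (map (λ pq → colParity (proj₁ pq) ℙ.+ colParity (proj₂ pq)) ps))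
      odd≡ = begin
        length (ofParity 1ℙ (differences xs))
          ≡⟨ length-ofParity-map 1ℙ (differences xs) ⟩
        length (filter (ℙ._≟ 1ℙ) (map parity (map (uncurry difference) ps)))
          ≡⟨ cong (length ∘ filter (ℙ._≟ 1ℙ))
                  (trans (sym (map-∘ {g = parity} {f = uncurry difference} ps))
                         (map-cong (uncurry (parity-difference n-even)) ps)) ⟩
        length (filter (ℙ._≟ 1ℙ) (map (λ pq → colParity (proj₁ pq) ℙ.+ colParity (proj₂ pq)) ps))
          ∎

-- Differences of an optical orthogonal code

n∤half : ∀ {b k} → b + b ≡ suc k → ¬ suc k ∣ b
n∤half {suc b} b+b≡n = >⇒∤ (subst (suc b <_) b+b≡n (m<m+n (suc b) z<s))

module Codewords {m k : ℕ} (C : List (KSubset m (suc k) 3)) (ooc : IsOOC m (suc k) 3 C) where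
  open IsOOC ooc
  private
    n : ℕ
    n = suc k

  codeword : Fin (length C) → List (Point m n)
  codeword a = elems (lookup C a)

  codeword-unique : ∀ a → Unique (codeword a)
  codeword-unique a = unique (lookup C a)

  interCard≥2⇒trivialShift : ∀ {a b τ} → 2 ≤ interCard (codeword a) (shift τ (codeword b)) →
                             a ≡ b × n ∣ τ
  interCard≥2⇒trivialShift {a} {b} {τ} 2≤ with a Fin.≟ b | n ∣? τ
  ... | no a≢b   | _       = contradiction (cross a b a≢b τ) (<⇒≱ 2≤)
  ... | yes refl | no n∤τ  = contradiction (auto a τ n∤τ) (<⇒≱ 2≤)
  ... | yes refl | yes n∣τ = refl , n∣τ

  difference-injective : ∀ {a b p q p′ q′} → p ∈ codeword a → q ∈ codeword a →
                         p′ ∈ codeword b → q′ ∈ codeword b → p ≢ q →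
                         difference p q ≡ difference p′ q′ → a ≡ b × p ≡ p′ × q ≡ q′
  difference-injective {a} {b} {p} {q} {p′} {q′} p∈ q∈ p′∈ q′∈ p≢q eq =
    a≡b , trans (sym p′↦p) (shiftPt-∣ n∣τ p′) , trans (sym q′↦q) (shiftPt-∣ n∣τ q′)
    where
      τ = toℕ (colDiff (proj₂ p′) (proj₂ p))
      p′↦p : shiftPt τ p′ ≡ p
      p′↦p = proj₁ (difference-translate eq)
      q′↦q : shiftPt τ q′ ≡ q
      q′↦q = proj₂ (difference-translate eq)
      trivial : a ≡ b × n ∣ τ
      trivial = interCard≥2⇒trivialShift (interCard≥2 p≢q p∈ q∈
        (subst (_∈ shift τ (codeword b)) p′↦p (∈-map⁺ (shiftPt τ) p′∈))
        (subst (_∈ shift τ (codeword b)) q′↦q (∈-map⁺ (shiftPt τ) q′∈)))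
      a≡b = proj₁ trivial
      n∣τ = proj₂ trivial

  difference≢halfTurn : ∀ {a p q i d} → toℕ d + toℕ d ≡ n → p ∈ codeword a → q ∈ codeword a →
                        p ≢ q → difference p q ≢ diffCode i i d
  difference≢halfTurn {a} {p} {q} {d = d} d+d≡n p∈ q∈ p≢q eq =
    n∤half d+d≡n (proj₂ (interCard≥2⇒trivialShift (interCard≥2 p≢q p∈ q∈ p∈shift q∈shift)))
    where
      δ = toℕ d
      p↦q : shiftPt δ p ≡ q
      p↦q = difference-diagonal eq
      q↦p : shiftPt δ q ≡ p
      q↦p = begin
        shiftPt δ q                ≡⟨ cong (shiftPt δ) p↦q ⟨
        shiftPt δ (shiftPt δ p)    ≡⟨ shiftPt-+ δ δ p ⟩
        shiftPt (δ + δ) p          ≡⟨ shiftPt-∣ (subst (n ∣_) (sym d+d≡n) ∣-refl) p ⟩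
        p                          ∎
        where open ≡-Reasoning
      p∈shift = subst (_∈ shift δ (codeword a)) q↦p (∈-map⁺ (shiftPt δ) q∈)
      q∈shift = subst (_∈ shift δ (codeword a)) p↦q (∈-map⁺ (shiftPt δ) p∈)

  differences-unique : ∀ a → Unique (differences (codeword a))
  differences-unique a = unique-map⁺ injective (orderedPairs⁺ (codeword-unique a))
    where
      injective : ∀ {pq pq′} → pq ∈ orderedPairs (codeword a) → pq′ ∈ orderedPairs (codeword a) →
                  uncurry difference pq ≡ uncurry difference pq′ → pq ≡ pq′
      injective pq∈ pq′∈ eq
        with p∈ , q∈ , p≢q ← ∈-orderedPairs⁻ (codeword-unique a) pq∈
        with p′∈ , q′∈ , _ ← ∈-orderedPairs⁻ (codeword-unique a) pq′∈
        with _ , refl , refl ← difference-injective p∈ q∈ p′∈ q′∈ p≢q eq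
        = refl

  differences-disjoint : ∀ {a b} → a ≢ b → Disjoint (differences (codeword a)) (differences (codeword b))
  differences-disjoint {a} {b} a≢b (d∈a , d∈b)
    with p , q , p∈ , q∈ , p≢q , refl ← ∈-differences⁻ (codeword-unique a) d∈a
    with _ , _ , p′∈ , q′∈ , _ , eq ← ∈-differences⁻ (codeword-unique b) d∈b
    = a≢b (proj₁ (difference-injective p∈ q∈ p′∈ q′∈ p≢q eq))

module Counting {m k : ℕ} (C : List (KSubset m (suc k) 3)) (ooc : IsOOC m (suc k) 3 C)
                (b : ℕ) (n≡b*2 : suc k ≡ b * 2) where
  open Codewords C ooc

  private
    n : ℕ
    n = suc k
    M : ℕ
    M = m * m * b

  b+b≡n : b + b ≡ n
  b+b≡n = trans (double b) (sym n≡b*2)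
    where
      double : ∀ b → b + b ≡ b * 2
      double = solve-∀

  n-even : parity n ≡ 0ℙ
  n-even = trans (cong parity n≡b*2) (parity-*even b 2 refl)

  b≢0 : b ≢ 0
  b≢0 b≡0 = 0≢1+n (trans (cong (λ x → x + x) (sym b≡0)) b+b≡n)

  b<n : b < n
  b<n = subst (b <_) b+b≡n (m<m+n b (n≢0⇒n>0 b≢0))

  half : Fin n
  half = fromℕ< b<n

  half+half≡n : toℕ half + toℕ half ≡ n
  half+half≡n = trans (cong₂ _+_ (toℕ-fromℕ< b<n) (toℕ-fromℕ< b<n)) b+b≡n

  used : List ℕ
  used = concat (tabulate (differences ∘ codeword))

  diagonal : Fin n → List ℕ
  diagonal d = tabulate (λ (i : Fin m) → diffCode i i d)

  excluded : List ℕ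
  excluded = diagonal Fin.zero ++ diagonal half

  claimed : List ℕ
  claimed = used ++ excluded

  ∈-used⁻ : ∀ {d} → d ∈ used → ∃[ a ] d ∈ differences (codeword a)
  ∈-used⁻ d∈
    with xs , d∈xs , xs∈ ← ∈-concat⁻′ (tabulate (differences ∘ codeword)) d∈
    with a , refl ← ∈-tabulate⁻ xs∈
    = a , d∈xs

  ∈-diagonal⁻ : ∀ {d e} → e ∈ diagonal d → ∃[ i ] e ≡ diffCode i i d
  ∈-diagonal⁻ {d} = ∈-tabulate⁻ {f = λ (i : Fin m) → diffCode i i d}

  used-unique : Unique used
  used-unique = Unique.concat⁺ (All.tabulate⁺ differences-unique) (AllPairs.tabulate⁺ differences-disjoint)

  excluded-unique : Unique excluded
  excluded-unique = Unique.++⁺ (diagonal-unique Fin.zero) (diagonal-unique half) zero≢half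
    where
      diagonal-unique : ∀ d → Unique (diagonal d)
      diagonal-unique d = Unique.tabulate⁺ (proj₁ ∘ diffCode-injective)
      zero≢half : Disjoint (diagonal Fin.zero) (diagonal half)
      zero≢half (e∈₀ , e∈₁)
        with _ , e≡₀ ← ∈-diagonal⁻ e∈₀
        with _ , e≡₁ ← ∈-diagonal⁻ e∈₁
        with _ , _ , zero≡half ← diffCode-injective (trans (sym e≡₀) e≡₁)
        = b≢0 (sym (trans (cong toℕ zero≡half) (toℕ-fromℕ< b<n)))

  claimed-unique : Unique claimed
  claimed-unique = Unique.++⁺ used-unique excluded-unique used-excluded-disjoint
    where
      used-excluded-disjoint : Disjoint used excluded
      used-excluded-disjoint (e∈u , e∈x)
        with a , e∈a ← ∈-used⁻ e∈u
        with p , q , p∈ , q∈ , p≢q , refl ← ∈-differences⁻ (codeword-unique a) e∈a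
        with ∈-++⁻ (diagonal Fin.zero) e∈x
      ... | inj₁ e∈₀ with _ , eq ← ∈-diagonal⁻ e∈₀ = difference≢diagonal-zero p≢q eq
      ... | inj₂ e∈₁ with _ , eq ← ∈-diagonal⁻ e∈₁ = difference≢halfTurn half+half≡n p∈ q∈ p≢q eq

  claimed-bounded : All (_< M + M) claimed
  claimed-bounded = All.map (λ {e} → subst (e <_) m*m*n≡M+M)
    (All.++⁺ used-bounded (All.++⁺ (diagonal-bounded Fin.zero) (diagonal-bounded half)))
    where
      m*m*n≡M+M : m * m * n ≡ M + M
      m*m*n≡M+M = trans (cong (m * m *_) n≡b*2) (double m b)
        where
          double : ∀ m b → m * m * (b * 2) ≡ m * m * b + m * m * b
          double = solve-∀
      used-bounded : All (_< m * m * n) used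
      used-bounded = All.concat⁺ (All.tabulate⁺ {f = differences ∘ codeword} λ a →
                       All.map⁺ (All.universal (uncurry difference<) (orderedPairs (codeword a))))
      diagonal-bounded : ∀ d → All (_< m * m * n) (diagonal d)
      diagonal-bounded d = All.tabulate⁺ {f = λ (i : Fin m) → diffCode i i d} (λ i → diffCode< i i d)

  length-diagonal : ∀ d → length (diagonal d) ≡ m
  length-diagonal d = length-tabulate (λ (i : Fin m) → diffCode i i d)

  length-claimed : length claimed ≡ length C * 6 + (m + m)
  length-claimed = trans (length-++ used) (cong₂ _+_ length-used length-excluded)
    where
      length-used : length used ≡ length C * 6
      length-used = trans
        (length-concat-uniform _ (All.tabulate⁺ {f = differences ∘ codeword} λ a →
                                    length-differences₃ (codeword a) (size (lookup C a))))
        (cong (_* 6) (length-tabulate (differences ∘ codeword)))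
      length-excluded : length excluded ≡ m + m
      length-excluded = trans (length-++ (diagonal Fin.zero))
                              (cong₂ _+_ (length-diagonal Fin.zero) (length-diagonal half))

  4∣odd-used : 4 ∣ length (ofParity 1ℙ used)
  4∣odd-used = ∣-length-ofParity-concat _ (All.tabulate⁺ {f = differences ∘ codeword} λ a →
                 4∣odd-differences₃ n-even (codeword a) (size (lookup C a)))

  odd-diagonal : ∀ d → length (ofParity 1ℙ (diagonal d)) ≡ m * bit (parity (toℕ d))
  odd-diagonal d = trans
    (length-ofParity-constant (parity (toℕ d))
      (All.tabulate⁺ {f = λ (i : Fin m) → diffCode i i d} λ i → parity-diffCode n-even i i d))
    (cong (_* bit (parity (toℕ d))) (length-diagonal d))

  odd-excluded : length (ofParity 1ℙ excluded) ≡ m * bit (parity b)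
  odd-excluded = begin
    length (ofParity 1ℙ (diagonal Fin.zero ++ diagonal half))
      ≡⟨ cong length (filter-++ _ (diagonal Fin.zero) (diagonal half)) ⟩
    length (ofParity 1ℙ (diagonal Fin.zero) ++ ofParity 1ℙ (diagonal half))
      ≡⟨ length-++ (ofParity 1ℙ (diagonal Fin.zero)) ⟩
    length (ofParity 1ℙ (diagonal Fin.zero)) + length (ofParity 1ℙ (diagonal half))
      ≡⟨ cong₂ _+_ (odd-diagonal Fin.zero) (odd-diagonal half) ⟩
    m * 0 + m * bit (parity (toℕ half))
      ≡⟨ cong₂ _+_ (*-zeroʳ m) (cong (λ x → m * bit (parity x)) (toℕ-fromℕ< b<n)) ⟩
    m * bit (parity b)
      ∎
    where open ≡-Reasoning

  odd-claimed≡M : ∀ J → J * 6 + (m + m) ≡ M + M → J ≤ length C → length (ofParity 1ℙ claimed) ≡ M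
  odd-claimed≡M J J-identity J≤|C| =
    sum-squeeze (length-ofParity≤ M 0ℙ claimed-unique claimed-bounded)
                (length-ofParity≤ M 1ℙ claimed-unique claimed-bounded)
                (begin
                  M + M                    ≡⟨ J-identity ⟨
                  J * 6 + (m + m)          ≤⟨ +-monoˡ-≤ (m + m) (*-monoˡ-≤ 6 J≤|C|) ⟩
                  length C * 6 + (m + m)   ≡⟨ length-claimed ⟨
                  length claimed           ≡⟨ length-ofParity claimed ⟨
                  length (ofParity 0ℙ claimed) + length (ofParity 1ℙ claimed) ∎)
    where open ≤-Reasoning

  J≤|C|⇒residue : ∀ J → J * 6 + (m + m) ≡ M + M → J ≤ length C →
                  ∃[ t ] M ≡ t * 4 + m * bit (parity b)
  J≤|C|⇒residue J J-identity J≤|C| with divides t odd-used≡ ← 4∣odd-used = t , (begin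
    M                                                           ≡⟨ odd-claimed≡M J J-identity J≤|C| ⟨
    length (ofParity 1ℙ (used ++ excluded))                     ≡⟨ cong length (filter-++ _ used excluded) ⟩
    length (ofParity 1ℙ used ++ ofParity 1ℙ excluded)           ≡⟨ length-++ (ofParity 1ℙ used) ⟩
    length (ofParity 1ℙ used) + length (ofParity 1ℙ excluded)   ≡⟨ cong₂ _+_ odd-used≡ odd-excluded ⟩
    t * 4 + m * bit (parity b)                                  ∎)
    where open ≡-Reasoning

-- The arithmetic of the hypothesis

residues-mod4 : ∀ (u v : Fin 4) → let u = toℕ u; v = toℕ v in
                (u * v % 4 ≡ 2 ⊎ u * v % 4 ≡ 3) → u * u * v % 4 ≢ u * bit (parity v) % 4
residues-mod4 = toWitness {a? = all? λ u → all? λ v → let u = toℕ u; v = toℕ v in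
  ((u * v % 4 ≟ 2) ⊎-dec (u * v % 4 ≟ 3)) →-dec ¬? (u * u * v % 4 ≟ u * bit (parity v) % 4)} _

mod4-obstruction : ∀ m b t → (m * b % 4 ≡ 2 ⊎ m * b % 4 ≡ 3) → m * m * b ≢ t * 4 + m * bit (parity b)
mod4-obstruction m b t mb%4 eq = residues-mod4 (m mod 4) (b mod 4)
  (Sum.map (trans uv≡mb) (trans uv≡mb) mb%4)
  (begin
    u * u * v % 4            ≡⟨ %-*-cong 4 (m * m) (u * u) b v (%-*-cong 4 m u m u m≡u m≡u) b≡v ⟨
    m * m * b % 4            ≡⟨ cong (_% 4) eq ⟩
    (t * 4 + m * c) % 4      ≡⟨ cong (_% 4) (+-comm (t * 4) (m * c)) ⟩
    (m * c + t * 4) % 4      ≡⟨ [m+kn]%n≡m%n (m * c) t 4 ⟩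
    m * c % 4                ≡⟨ %-*-cong 4 m u c c m≡u refl ⟩
    u * c % 4                ≡⟨ cong (λ p → u * bit p % 4) parity-v ⟨
    u * bit (parity v) % 4   ∎)
  where
    open ≡-Reasoning
    u = toℕ (m mod 4)
    v = toℕ (b mod 4)
    c = bit (parity b)
    ≡residue : ∀ a → a % 4 ≡ toℕ (a mod 4) % 4
    ≡residue a = trans (sym (m%n%n≡m%n a 4)) (cong (_% 4) (sym (toℕ-mod a 4)))
    m≡u = ≡residue m
    b≡v = ≡residue b
    uv≡mb : u * v % 4 ≡ m * b % 4
    uv≡mb = sym (%-*-cong 4 m u b v m≡u b≡v)
    parity-v : parity v ≡ parity b
    parity-v = trans (cong parity (toℕ-mod b 4)) (parity-% b 4 refl)

J3-identity : ∀ m b s → m * b ≡ suc s → 3 ∣ m * s → J3 m (b * 2) * 6 + (m + m) ≡ m * m * b + m * m * b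
J3-identity m b s mb≡1+s 3∣ms = begin
  J3 m (b * 2) * 6 + (m + m)          ≡⟨ cong (λ j → j * 6 + (m + m)) J3≡ ⟩
  m * s / 3 * 6 + (m + m)             ≡⟨ cong (_+ (m + m)) (*-assoc (m * s / 3) 3 2) ⟨
  m * s / 3 * 3 * 2 + (m + m)         ≡⟨ cong (λ x → x * 2 + (m + m)) (m/n*n≡m 3∣ms) ⟩
  m * s * 2 + (m + m)                 ≡⟨ distrib m s ⟩
  m * suc s + m * suc s               ≡⟨ cong (λ x → m * x + m * x) mb≡1+s ⟨
  m * (m * b) + m * (m * b)           ≡⟨ cong (λ x → x + x) (*-assoc m m b) ⟨
  m * m * b + m * m * b               ∎
  where
    open ≡-Reasoning
    distrib : ∀ m s → m * s * 2 + (m + m) ≡ m * suc s + m * suc s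
    distrib = solve-∀
    [1+2s]/2≡s : suc (s * 2) / 2 ≡ s
    [1+2s]/2≡s = trans (+-distrib-/-∣ʳ 1 {d = 2} (divides s refl)) (m*n/n≡m s 2)
    J3≡ : J3 m (b * 2) ≡ m * s / 3
    J3≡ = trans (cong (λ x → m * ((x ∸ 1) / 2) / 3) (trans (sym (*-assoc m b 2)) (cong (_* 2) mb≡1+s)))
                (cong (λ x → m * x / 3) [1+2s]/2≡s)

module _ (m b : ℕ) where

  mn%24⇒mb%12 : ∀ r → m * (b * 2) % 24 ≡ r * 2 → m * b % 12 ≡ r
  mn%24⇒mb%12 r mn%24≡2r = *-cancelʳ-≡ (m * b % 12) r 2 (begin
    m * b % 12 * 2     ≡⟨ m%n*o≡m*o%[n*o] (m * b) 12 2 ⟩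
    m * b * 2 % 24     ≡⟨ cong (_% 24) (*-assoc m b 2) ⟩
    m * (b * 2) % 24   ≡⟨ mn%24≡2r ⟩
    r * 2              ∎)
    where open ≡-Reasoning

  mn%24≡2+2r⇒ : ∀ r → m * (b * 2) % 24 ≡ suc r * 2 → (∀ q → 3 ∣ m * (r + q * 12)) →
           m * b % 4 ≡ suc r % 4 × J3 m (b * 2) * 6 + (m + m) ≡ m * m * b + m * m * b
  mn%24≡2+2r⇒ r mn%24≡2r 3∣ = mb%4 , J3-identity m b (r + q * 12) mb≡ (3∣ q)
    where
      q = m * b / 12
      mb%12 = mn%24⇒mb%12 (suc r) mn%24≡2r
      mb%4 : m * b % 4 ≡ suc r % 4
      mb%4 = trans (sym (m∣n⇒o%n%m≡o%m 4 12 (m * b) (divides 3 refl))) (cong (_% 4) mb%12)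
      mb≡ : m * b ≡ suc (r + q * 12)
      mb≡ = trans (m≡m%n+[m/n]*n (m * b) 12) (cong (_+ q * 12) mb%12)

  hypothesis⇒ : ((3 ∣ m × (m * (b * 2) % 24 ≡ 6 ⊎ m * (b * 2) % 24 ≡ 12)) ⊎
                 (m * (b * 2) % 24 ≡ 14 ⊎ m * (b * 2) % 24 ≡ 20)) →
                (m * b % 4 ≡ 2 ⊎ m * b % 4 ≡ 3) × J3 m (b * 2) * 6 + (m + m) ≡ m * m * b + m * m * b
  hypothesis⇒ (inj₁ (3∣m , inj₁ h)) = map₁ inj₂ (mn%24≡2+2r⇒ 2 h λ _ → ∣m⇒∣m*n _ 3∣m)
  hypothesis⇒ (inj₁ (3∣m , inj₂ h)) = map₁ inj₁ (mn%24≡2+2r⇒ 5 h λ _ → ∣m⇒∣m*n _ 3∣m)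
  hypothesis⇒ (inj₂ (inj₁ h))       = map₁ inj₂ (mn%24≡2+2r⇒ 6 h λ q →
                                        ∣n⇒∣m*n m (∣m∣n⇒∣m+n (divides 2 refl) (∣n⇒∣m*n q (divides 4 refl))))
  hypothesis⇒ (inj₂ (inj₂ h))       = map₁ inj₁ (mn%24≡2+2r⇒ 9 h λ q →
                                        ∣n⇒∣m*n m (∣m∣n⇒∣m+n (divides 3 refl) (∣n⇒∣m*n q (divides 4 refl))))

lemma3p1 : (m n : ℕ) → m ≥ 1 → n ≥ 1 → 2 ∣ n →
    ((3 ∣ m × (m * n % 24 ≡ 6 ⊎ m * n % 24 ≡ 12)) ⊎ (m * n % 24 ≡ 14 ⊎ m * n % 24 ≡ 20)) →
    (C : List (KSubset m n 3)) → IsOOC m n 3 C → length C < J3 m n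
lemma3p1 m .(0 * 2)     _ ()  (divides zero refl)    _   _ _
lemma3p1 m .(suc b * 2) _ _   (divides (suc b) refl) hyp C ooc
  with mb%4 , J-identity ← hypothesis⇒ m (suc b) hyp
  = ≰⇒> λ J≤|C| →
      let t , M≡ = Counting.J≤|C|⇒residue C ooc (suc b) refl (J3 m (suc b * 2)) J-identity J≤|C|
      in mod4-obstruction m (suc b) t mb%4 M≡
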